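{- (1) If $\ell$ is an odd prime and $a_1,a_2$ are integers with $0\leq a_1,a_2<\ell$ satisfying $\left(\frac{ -16a_1+8a_2+1}{\ell}\right)=-1$, then $p_2(a_1,\ell;\ell n+a_2)=0$ for every non-negative integer $n$. (2) If $\ell\equiv 2\pmod 3$ is prime and $a_1,a_2$ are integers with $0\leq a_1,a_2<\ell^2$ such that $\mathrm{ord}_\ell(-9a_1+3a_2+1)=1$, then $p_3(a_1,\ell^2;\ell^2n+a_2)=0$ for every non-negative integer $n$.
   Context: For a partition $\lambda$, the node in row $k$ and column $j$ of its Ferrers–Young diagram has hook length $h(k,j)=(\lambda_k-k)+(\lambda'_j-j)+1$, where $\lambda'_j$ is the number of nodes in column $j$; $\mathcal{H}_t(\lambda)$ is the multiset of hook lengths of $\lambda$ divisible by $t$. Define $p_t(a,b;n):=\#\{\lambda\vdash n:\ \#\mathcal{H}_t(\lambda)\equiv a\pmod b\}$. $\left(\frac{\cdot}{\ell}\right)$ is the Legendre symbol and $\mathrm{ord}_\ell$ is the $\ell$-adic valuation. -}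

module Defs where

open import Data.Nat as ℕ using (ℕ; zero; suc; _≤?_; _∸_)
open import Data.Nat.Divisibility as ℕD using (_∣?_)
open import Data.Integer as ℤ using (ℤ; +_; -[1+_]; ∣_∣)
open import Data.Integer.Divisibility as ℤD using ()
open import Data.List using (List; []; _∷_; length; filter; map; concat; upTo)
open import Data.Nat.ListAction using (sum)
open import Data.List.Relation.Unary.All using (All)
open import Data.List.Relation.Unary.Any using (any?)
open import Data.List.Relation.Unary.Linked using (Linked)
open import Data.Product using (_×_)
open import Relation.Binary.PropositionalEquality using (_≡_)
open import Relation.Nullary using (¬_; yes; no)

record Partition (n : ℕ) : Set where
  constructor mkPartition
  field
    parts    : List ℕ
    positive : All (λ x → 1 ℕ.≤ x) parts
    decr     : Linked ℕ._≥_ parts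
    total    : sum parts ≡ n
open Partition public

conj : List ℕ → ℕ → ℕ
conj λs j = length (filter (j ≤?_) λs)

oneTo : ℕ → List ℕ
oneTo m = map suc (upTo m)

-- hook lengths of the rows of λ, starting with row index k
-- h(k,j) = (λ_k - k) + (λ'_j - j) + 1 ; written as (λ_k - j) + (λ'_j - k) + 1,
-- which is the same number and avoids truncated subtraction issues
-- (λ_k ≥ j and λ'_j ≥ k for every node (k,j)).
hooksFrom : List ℕ → ℕ → List ℕ → List ℕ
hooksFrom full k []         = []
hooksFrom full k (λk ∷ rest) =
  map (λ j → suc ((λk ∸ j) ℕ.+ (conj full j ∸ k))) (oneTo λk)
  Data.List.++ hooksFrom full (suc k) rest

hooks : List ℕ → List ℕ
hooks λs = hooksFrom λs 1 λs

#H : ℕ → List ℕ → ℕ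
#H t λs = length (filter (t ∣?_) (hooks λs))

_≡_[mod_] : ℕ → ℕ → ℕ → Set
x ≡ a [mod b ] = (+ b) ℤD.∣ ((+ x) ℤ.- (+ a))

p-vanishes : (t a b n : ℕ) → Set
p-vanishes t a b n = (λp : Partition n) → ¬ (#H t (parts λp) ≡ a [mod b ])

legendre : ℤ → ℕ → ℤ
legendre m p with p ∣? ∣ m ∣
... | yes _ = + 0
... | no _ with any? (λ x → p ∣? ∣ ((+ x) ℤ.* (+ x)) ℤ.- m ∣) (upTo p)
...   | yes _ = + 1
...   | no _  = -[1+ 0 ]

ord≡ : ℕ → ℤ → ℕ → Set
ord≡ p m k = ((+ (p ℕ.^ k)) ℤD.∣ m) × ¬ ((+ (p ℕ.^ suc k)) ℤD.∣ m)

module Submission where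

-- Peeling off the largest part λ₁ of λ, the first-row hooks divisible by t are counted by the
-- columns j whose λ'_j − j lies in a fixed class mod t.  Following these counts through the
-- charges of λ (the coordinates of its t-core) gives, by induction on the number of parts,
--   |λ| = 2k² − k + 2·#H₂(λ)   and   |λ| = 3(x² + xy + y²) − x + y + 3·#H₃(λ).
-- Hence (4k − 1)² = 8|λ| − 16·#H₂(λ) + 1: a partition counted by p₂(a₁, ℓ; ℓn + a₂) makes
-- −16a₁ + 8a₂ + 1 a square mod ℓ.  With u = −3x − 3y and v = 3y + 1,
-- u² + uv + v² = 3|λ| − 9·#H₃(λ) + 1 ≡ −9a₁ + 3a₂ + 1 (mod ℓ²); for ℓ ≡ 2 (mod 3), Fermat's little
-- theorem shows that ℓ ∣ u² + uv + v² forces ℓ ∣ u and ℓ ∣ v, so ℓ² divides −9a₁ + 3a₂ + 1.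

open import Defs
open import Data.Nat using (ℕ)

module HookCounting where
  open import Data.Nat using (ℕ; zero; suc; _≤_; _<_; _+_; _*_; _∸_; z<s; s<s; _≤?_)
  open import Data.Nat.Properties
  open import Data.Nat.Divisibility using (_∣_; _∣?_; ∣m+n∣m⇒∣n; ∣m∣n⇒∣m+n; m∣m*n)
  open import Data.Nat.Tactic.RingSolver using (solve-∀)
  open import Data.List using (List; []; _∷_; length; filter; map; _++_; upTo; applyUpTo)
  open import Data.List.Properties using (map-∘; map-upTo; map-cong-local; length-++; filter-++; filter-accept; filter-reject)
  open import Data.List.Relation.Unary.All.Properties using (map⁺; applyUpTo⁺₁)
  open import Data.List.Relation.Unary.All using (All; []; _∷_)
  open import Data.Empty using (⊥-elim)
  open import Function using (_∘_; id)
  open import Relation.Nullary using (¬_; yes; no)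
  open import Relation.Binary.PropositionalEquality

  ∑< : ℕ → (ℕ → ℕ) → ℕ
  ∑< zero    f = 0
  ∑< (suc n) f = f 0 + ∑< n (f ∘ suc)

  syntax ∑< n (λ i → e) = ∑[ i < n ] e

  ∑-cong : ∀ n {f g : ℕ → ℕ} → (∀ i → i < n → f i ≡ g i) → ∑< n f ≡ ∑< n g
  ∑-cong zero    f≗g = refl
  ∑-cong (suc n) f≗g = cong₂ _+_ (f≗g 0 z<s) (∑-cong n (λ i i<n → f≗g (suc i) (s<s i<n)))

  ∑-+ : ∀ m n (f : ℕ → ℕ) → ∑< (m + n) f ≡ ∑< m f + ∑[ i < n ] f (m + i)
  ∑-+ zero    n f = refl
  ∑-+ (suc m) n f = trans (cong (f 0 +_) (∑-+ m n (f ∘ suc))) (sym (+-assoc (f 0) _ _))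

  𝟙[_∣_] : ℕ → ℕ → ℕ
  𝟙[ t ∣ x ] with t ∣? x
  ... | yes _ = 1
  ... | no  _ = 0

  𝟙-cong : ∀ {t x y} → (t ∣ x → t ∣ y) → (t ∣ y → t ∣ x) → 𝟙[ t ∣ x ] ≡ 𝟙[ t ∣ y ]
  𝟙-cong {t} {x} {y} x⇒y y⇒x with t ∣? x | t ∣? y
  ... | yes _   | yes _   = refl
  ... | no  _   | no  _   = refl
  ... | yes t∣x | no  t∤y = ⊥-elim (t∤y (x⇒y t∣x))
  ... | no  t∤x | yes t∣y = ⊥-elim (t∤x (y⇒x t∣y))

  𝟙-+-multiple : ∀ t x k → 𝟙[ t ∣ x + t * k ] ≡ 𝟙[ t ∣ x ]
  𝟙-+-multiple t x k = 𝟙-cong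
    (λ t∣x+tk → ∣m+n∣m⇒∣n (subst (t ∣_) (+-comm x (t * k)) t∣x+tk) (m∣m*n k))
    (λ t∣x → ∣m∣n⇒∣m+n t∣x (m∣m*n k))

  length-filter-applyUpTo : ∀ t (f : ℕ → ℕ) n →
    length (filter (t ∣?_) (applyUpTo f n)) ≡ ∑[ i < n ] 𝟙[ t ∣ f i ]
  length-filter-applyUpTo t f zero = refl
  length-filter-applyUpTo t f (suc n) with t ∣? f 0
  ... | yes _ = cong suc (length-filter-applyUpTo t (f ∘ suc) n)
  ... | no  _ = length-filter-applyUpTo t (f ∘ suc) n

  conj-∷-≥ : ∀ {j L} λs → j ≤ L → conj (L ∷ λs) j ≡ suc (conj λs j)
  conj-∷-≥ λs j≤L = cong length (filter-accept (_ ≤?_) j≤L)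

  conj-∷-< : ∀ {j L} λs → ¬ j ≤ L → conj (L ∷ λs) j ≡ conj λs j
  conj-∷-< λs j≰L = cong length (filter-reject (_ ≤?_) j≰L)

  All-oneTo : ∀ {P : ℕ → Set} n → (∀ {i} → i < n → P (suc i)) → All P (oneTo n)
  All-oneTo n P = map⁺ (applyUpTo⁺₁ id n P)

  map-oneTo : ∀ (g : ℕ → ℕ) n → map g (oneTo n) ≡ applyUpTo (g ∘ suc) n
  map-oneTo g n = trans (sym (map-∘ (upTo n))) (map-upTo (g ∘ suc) n)

  hooksFrom-∷ : ∀ L λs k rows → All (_≤ L) rows → hooksFrom (L ∷ λs) (suc k) rows ≡ hooksFrom λs k rows
  hooksFrom-∷ L λs k []           []            = refl
  hooksFrom-∷ L λs k (r ∷ rows) (r≤L ∷ rows≤L) = cong₂ _++_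
    (map-cong-local (All-oneTo r λ {i} i<r →
       cong (λ c → suc ((r ∸ suc i) + (c ∸ suc k))) (conj-∷-≥ λs (≤-trans i<r r≤L))))
    (hooksFrom-∷ L λs (suc k) rows rows≤L)

  #H-∷ : ∀ t L λs → All (_≤ L) λs →
    #H t (L ∷ λs) ≡ ∑[ i < L ] 𝟙[ t ∣ suc ((L ∸ suc i) + conj λs (suc i)) ] + #H t λs
  #H-∷ t L λs λs≤L = begin
    length (filter (t ∣?_) (map firstRow (oneTo L) ++ hooksFrom (L ∷ λs) 2 λs))
      ≡⟨ cong (λ hs → length (filter (t ∣?_) (map firstRow (oneTo L) ++ hs))) (hooksFrom-∷ L λs 1 λs λs≤L) ⟩
    length (filter (t ∣?_) (map firstRow (oneTo L) ++ hooks λs))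
      ≡⟨ cong length (filter-++ (t ∣?_) (map firstRow (oneTo L)) (hooks λs)) ⟩
    length (filter (t ∣?_) (map firstRow (oneTo L)) ++ filter (t ∣?_) (hooks λs))
      ≡⟨ length-++ (filter (t ∣?_) (map firstRow (oneTo L))) ⟩
    length (filter (t ∣?_) (map firstRow (oneTo L))) + #H t λs
      ≡⟨ cong (λ hs → length (filter (t ∣?_) hs) + #H t λs) (map-oneTo firstRow L) ⟩
    length (filter (t ∣?_) (applyUpTo (firstRow ∘ suc) L)) + #H t λs
      ≡⟨ cong (_+ #H t λs) (length-filter-applyUpTo t (firstRow ∘ suc) L) ⟩
    ∑[ i < L ] 𝟙[ t ∣ firstRow (suc i) ] + #H t λs
      ≡⟨ cong (_+ #H t λs) (∑-cong L λ i i<L →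
           cong (λ c → 𝟙[ t ∣ suc ((L ∸ suc i) + (c ∸ 1)) ]) (conj-∷-≥ λs i<L)) ⟩
    ∑[ i < L ] 𝟙[ t ∣ suc ((L ∸ suc i) + conj λs (suc i)) ] + #H t λs ∎
    where
    open ≡-Reasoning
    firstRow : ℕ → ℕ
    firstRow j = suc ((L ∸ j) + (conj (L ∷ λs) j ∸ 1))

  -- colCount m s L λs counts the columns j ≤ L with λ'_j − j ≡ −s (mod m + 1);
  -- the summand m·j stands for −j, which avoids truncated subtraction.
  colCount : (m s L : ℕ) → List ℕ → ℕ
  colCount m s L λs = ∑[ i < L ] 𝟙[ suc m ∣ s + conj λs (suc i) + m * suc i ]

  #H-∷-colCount : ∀ m L λs → All (_≤ L) λs → #H (suc m) (L ∷ λs) ≡ colCount m (suc L) L λs + #H (suc m) λs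
  #H-∷-colCount m L λs λs≤L = trans (#H-∷ (suc m) L λs λs≤L) (cong (_+ #H (suc m) λs) (∑-cong L λ i i<L →
    trans (sym (𝟙-+-multiple (suc m) _ (suc i)))
          (cong 𝟙[ suc m ∣_] (trans (shift (L ∸ suc i) (conj λs (suc i)) i m)
                                    (cong (λ l → suc l + conj λs (suc i) + m * suc i) (m∸n+n≡m i<L))))))
    where
    shift : ∀ d c i m → suc (d + c) + suc m * suc i ≡ suc (d + suc i) + c + m * suc i
    shift = solve-∀

  colCount-∷ : ∀ m s {L M} rest → M ≤ L →
    colCount m s L (M ∷ rest) + colCount m s M rest ≡ colCount m s L rest + colCount m (suc s) M rest
  colCount-∷ m s {L} {M} rest M≤L = begin
    colCount m s L (M ∷ rest) + C  ≡⟨ cong (λ l → colCount m s l (M ∷ rest) + C) (sym M+k≡L) ⟩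
    colCount m s (M + k) (M ∷ rest) + C  ≡⟨ cong (_+ C) (∑-+ M k _) ⟩
    ∑< M (term (M ∷ rest)) + ∑[ i < k ] term (M ∷ rest) (M + i) + C
      ≡⟨ cong₂ (λ a b → a + b + C)
           (∑-cong M λ i i<M → cong (λ c → 𝟙[ suc m ∣ s + c + m * suc i ]) (conj-∷-≥ rest i<M))
           (∑-cong k λ i _ → cong (λ c → 𝟙[ suc m ∣ s + c + m * suc (M + i) ])
                                  (conj-∷-< rest (λ M+i<M → m+n≮m M i M+i<M))) ⟩
    A + B + C  ≡⟨ swap A B C ⟩
    C + B + A
      ≡⟨ cong₂ _+_ (sym (∑-+ M k (term rest)))
                   (∑-cong M λ i _ → cong (λ x → 𝟙[ suc m ∣ x + m * suc i ]) (+-suc s _)) ⟩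
    colCount m s (M + k) rest + colCount m (suc s) M rest
      ≡⟨ cong (λ l → colCount m s l rest + colCount m (suc s) M rest) M+k≡L ⟩
    colCount m s L rest + colCount m (suc s) M rest ∎
    where
    open ≡-Reasoning
    term : List ℕ → ℕ → ℕ
    term λs i = 𝟙[ suc m ∣ s + conj λs (suc i) + m * suc i ]
    k : ℕ
    k = L ∸ M
    M+k≡L : M + k ≡ L
    M+k≡L = m+[n∸m]≡n M≤L
    A B C : ℕ
    A = ∑[ i < M ] 𝟙[ suc m ∣ s + suc (conj rest (suc i)) + m * suc i ]
    B = ∑[ i < k ] term rest (M + i)
    C = colCount m s M rest
    swap : ∀ a b c → a + b + c ≡ c + b + a
    swap = solve-∀

  colCount-+-multiple : ∀ m s q L λs → colCount m (s + q * suc m) L λs ≡ colCount m s L λs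
  colCount-+-multiple m s q L λs = ∑-cong L λ i _ →
    trans (cong 𝟙[ suc m ∣_] (regroup s q (conj λs (suc i)) m i)) (𝟙-+-multiple (suc m) _ q)
    where
    regroup : ∀ s q c m i → s + q * suc m + c + m * suc i ≡ s + c + m * suc i + suc m * q
    regroup = solve-∀

  window : ℕ → ℕ → ℕ
  window m x = ∑[ i < suc m ] 𝟙[ suc m ∣ x + m * i ]

  window-periodic : ∀ m x → window m (suc m + x) ≡ window m x
  window-periodic m x = ∑-cong (suc m) λ i _ →
    trans (cong 𝟙[ suc m ∣_] (regroup m x i)) (𝟙-+-multiple (suc m) _ 1)
    where
    regroup : ∀ m x i → suc m + x + m * i ≡ x + m * i + suc m * 1
    regroup = solve-∀

  window₂ : ∀ x → window 1 x ≡ 1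
  window₂ 0                   = refl
  window₂ 1                   = refl
  window₂ (suc (suc x))       = trans (window-periodic 1 x) (window₂ x)

  window₃ : ∀ x → window 2 x ≡ 1
  window₃ 0                   = refl
  window₃ 1                   = refl
  window₃ 2                   = refl
  window₃ (suc (suc (suc x))) = trans (window-periodic 2 x) (window₃ x)

  ∑-windows : ∀ m → (∀ x → window m x ≡ 1) → ∀ q x → ∑[ i < q * suc m ] 𝟙[ suc m ∣ x + m * i ] ≡ q
  ∑-windows m window≡1 zero    x = refl
  ∑-windows m window≡1 (suc q) x = begin
    ∑[ i < suc m + q * suc m ] 𝟙[ suc m ∣ x + m * i ]
      ≡⟨ ∑-+ (suc m) (q * suc m) (λ i → 𝟙[ suc m ∣ x + m * i ]) ⟩
    window m x + ∑[ i < q * suc m ] 𝟙[ suc m ∣ x + m * (suc m + i) ]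
      ≡⟨ cong₂ _+_ (window≡1 x) (∑-cong (q * suc m) λ i _ → cong 𝟙[ suc m ∣_] (regroup x m i)) ⟩
    1 + ∑[ i < q * suc m ] 𝟙[ suc m ∣ x + m * suc m + m * i ]
      ≡⟨ cong suc (∑-windows m window≡1 q (x + m * suc m)) ⟩
    suc q ∎
    where
    open ≡-Reasoning
    regroup : ∀ x m i → x + m * (suc m + i) ≡ x + m * suc m + m * i
    regroup = solve-∀

  -- window m x ≡ 1 holds for every m, but only m = 1, 2 (window₂, window₃) are needed.
  colCount-[]-+-multiple : ∀ m → (∀ x → window m x ≡ 1) →
    ∀ s ρ q → colCount m s (ρ + q * suc m) [] ≡ colCount m s ρ [] + q
  colCount-[]-+-multiple m window≡1 s ρ q = trans (∑-+ ρ (q * suc m) _) (cong (colCount m s ρ [] +_)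
    (trans (∑-cong (q * suc m) λ i _ → cong 𝟙[ suc m ∣_] (regroup s m ρ i))
           (∑-windows m window≡1 q (s + m * suc ρ))))
    where
    regroup : ∀ s m ρ i → s + 0 + m * suc (ρ + i) ≡ s + m * suc ρ + m * i
    regroup = solve-∀

module Charges where
  open HookCounting
  import Data.Nat as ℕ
  open import Data.Nat using (ℕ; suc; _≤_; _≥_; _<_; s≤s)
  import Data.Nat.Properties as ℕP
  open import Data.Nat.DivMod using (_%_; _/_; m%n<n; m≡m%n+[m/n]*n)
  open import Data.Nat.ListAction using (sum)
  open import Data.Integer using (ℤ; +_; 0ℤ; _+_; _-_; _*_; -_)
  open import Data.Integer.Properties using (pos-*; +-identityʳ; +-0-abelianGroup)
  open import Algebra.Properties.AbelianGroup +-0-abelianGroup using (inverseʳ-unique)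
  open import Data.Integer.Tactic.RingSolver using (solve-∀)
  open import Data.List using (List; []; _∷_)
  open import Data.List.Relation.Unary.All using (All; []; _∷_)
  open import Data.List.Relation.Unary.AllPairs using (_∷_)
  open import Data.List.Relation.Unary.Linked using (Linked; tail)
  open import Data.List.Relation.Unary.Linked.Properties using (Linked⇒AllPairs)
  open import Relation.Binary.PropositionalEquality

  -- By colCount-charge, charge m λs s = colCount m s L λs − colCount m s L [] for any L ≥ λ₁;
  -- these play the role of the charges (the t-core coordinates) of λs for t = m + 1.
  charge : ℕ → List ℕ → ℕ → ℤ
  charge m []         s = 0ℤ
  charge m (M ∷ rest) s = charge m rest (suc s) + (+ colCount m (suc s) M [] - + colCount m s M [])

  Linked-≥⇒All-≤ : ∀ {L r} → Linked _≥_ (L ∷ r) → All (_≤ L) r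
  Linked-≥⇒All-≤ lk with Linked⇒AllPairs (λ j≥k k≥l → ℕP.≤-trans k≥l j≥k) lk
  ... | L≥r ∷ _ = L≥r

  colCount-charge : ∀ m s L λs → Linked _≥_ λs → All (_≤ L) λs →
    + colCount m s L λs ≡ + colCount m s L [] + charge m λs s
  colCount-charge m s L []         _  _              = sym (+-identityʳ _)
  colCount-charge m s L (M ∷ rest) lk (M≤L ∷ rest≤L) = begin
    + colCount m s L (M ∷ rest)
      ≡⟨ subtract-right {c = colCount m s L rest} (colCount-∷ m s rest M≤L) ⟩
    + colCount m s L rest + + colCount m (suc s) M rest - + colCount m s M rest
      ≡⟨ cong₂ _-_ (cong₂ _+_ (colCount-charge m s L rest lk′ rest≤L) (colCount-charge m (suc s) M rest lk′ rest≤M))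
                   (colCount-charge m s M rest lk′ rest≤M) ⟩
    (+ colCount m s L [] + charge m rest s) + (+ colCount m (suc s) M [] + charge m rest (suc s))
      - (+ colCount m s M [] + charge m rest s)
      ≡⟨ regroup (+ colCount m s L []) (charge m rest s) (+ colCount m (suc s) M []) (charge m rest (suc s)) (+ colCount m s M []) ⟩
    + colCount m s L [] + charge m (M ∷ rest) s ∎
    where
    open ≡-Reasoning
    lk′ : Linked _≥_ rest
    lk′ = tail lk
    rest≤M : All (_≤ M) rest
    rest≤M = Linked-≥⇒All-≤ lk
    subtract-right : ∀ {a b c d} → a ℕ.+ b ≡ c ℕ.+ d → + a ≡ + c + + d - + b
    subtract-right {a} {b} {c} {d} eq = begin
      + a                   ≡⟨ add-sub (+ a) (+ b) ⟩
      + a + + b - + b       ≡⟨ cong (λ x → + x - + b) eq ⟩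
      + c + + d - + b       ∎
      where
      add-sub : ∀ x y → x ≡ x + y - y
      add-sub = solve-∀
    regroup : ∀ x k y k′ z → (x + k) + (y + k′) - (z + k) ≡ x + (k′ + (y - z))
    regroup = solve-∀

  charge-+-multiple : ∀ m λs s q → charge m λs (s ℕ.+ q ℕ.* suc m) ≡ charge m λs s
  charge-+-multiple m []         s q = refl
  charge-+-multiple m (M ∷ rest) s q = cong₂ _+_ (charge-+-multiple m rest (suc s) q)
    (cong₂ _-_ (cong +_ (colCount-+-multiple m (suc s) q M [])) (cong +_ (colCount-+-multiple m s q M [])))

  charge-sum₂ : ∀ λs → charge 1 λs 0 + charge 1 λs 1 ≡ 0ℤ
  charge-sum₂ []         = refl
  charge-sum₂ (M ∷ rest) = begin
    (charge 1 rest 1 + (c₁ - c₀)) + (charge 1 rest 2 + (c₂ - c₁))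
      ≡⟨ cong₂ (λ k c → (charge 1 rest 1 + (c₁ - c₀)) + (k + (c - c₁)))
               (charge-+-multiple 1 rest 0 1) (cong +_ (colCount-+-multiple 1 0 1 M [])) ⟩
    (charge 1 rest 1 + (c₁ - c₀)) + (charge 1 rest 0 + (c₀ - c₁))
      ≡⟨ telescope (charge 1 rest 0) (charge 1 rest 1) c₀ c₁ ⟩
    charge 1 rest 0 + charge 1 rest 1
      ≡⟨ charge-sum₂ rest ⟩
    0ℤ ∎
    where
    open ≡-Reasoning
    c₀ c₁ c₂ : ℤ
    c₀ = + colCount 1 0 M []
    c₁ = + colCount 1 1 M []
    c₂ = + colCount 1 2 M []
    telescope : ∀ k₀ k₁ c₀ c₁ → (k₁ + (c₁ - c₀)) + (k₀ + (c₀ - c₁)) ≡ k₀ + k₁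
    telescope = solve-∀

  charge-sum₃ : ∀ λs → charge 2 λs 0 + charge 2 λs 1 + charge 2 λs 2 ≡ 0ℤ
  charge-sum₃ []         = refl
  charge-sum₃ (M ∷ rest) = begin
    (charge 2 rest 1 + (c₁ - c₀)) + (charge 2 rest 2 + (c₂ - c₁)) + (charge 2 rest 3 + (c₃ - c₂))
      ≡⟨ cong₂ (λ k c → (charge 2 rest 1 + (c₁ - c₀)) + (charge 2 rest 2 + (c₂ - c₁)) + (k + (c - c₂)))
               (charge-+-multiple 2 rest 0 1) (cong +_ (colCount-+-multiple 2 0 1 M [])) ⟩
    (charge 2 rest 1 + (c₁ - c₀)) + (charge 2 rest 2 + (c₂ - c₁)) + (charge 2 rest 0 + (c₀ - c₂))
      ≡⟨ telescope (charge 2 rest 0) (charge 2 rest 1) (charge 2 rest 2) c₀ c₁ c₂ ⟩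
    charge 2 rest 0 + charge 2 rest 1 + charge 2 rest 2
      ≡⟨ charge-sum₃ rest ⟩
    0ℤ ∎
    where
    open ≡-Reasoning
    c₀ c₁ c₂ c₃ : ℤ
    c₀ = + colCount 2 0 M []
    c₁ = + colCount 2 1 M []
    c₂ = + colCount 2 2 M []
    c₃ = + colCount 2 3 M []
    telescope : ∀ k₀ k₁ k₂ c₀ c₁ c₂ →
      (k₁ + (c₁ - c₀)) + (k₂ + (c₂ - c₁)) + (k₀ + (c₀ - c₂)) ≡ k₀ + k₁ + k₂
    telescope = solve-∀

  module TopRow (m : ℕ) (window≡1 : ∀ x → window m x ≡ 1)
                {L : ℕ} (ρ q : ℕ) (L≡ρ+qt : L ≡ ρ ℕ.+ q ℕ.* suc m) where

    colCount-L : ∀ s → colCount m s L [] ≡ colCount m s ρ [] ℕ.+ q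
    colCount-L s = trans (cong (λ l → colCount m s l []) L≡ρ+qt) (colCount-[]-+-multiple m window≡1 s ρ q)

    size-∷ : ∀ r → + sum (L ∷ r) ≡ + ρ + + q * + suc m + + sum r
    size-∷ r = begin
      + (L ℕ.+ sum r)                       ≡⟨ cong (λ l → + (l ℕ.+ sum r)) L≡ρ+qt ⟩
      + (ρ ℕ.+ q ℕ.* suc m) + + sum r       ≡⟨ cong (λ x → + ρ + x + + sum r) (pos-* q (suc m)) ⟩
      + ρ + + q * + suc m + + sum r ∎
      where open ≡-Reasoning

    charge-∷ : ∀ r s → charge m (L ∷ r) s ≡ charge m r (suc s) + (+ colCount m (suc s) ρ [] - + colCount m s ρ [])
    charge-∷ r s = cong (λ δ → charge m r (suc s) + δ) (begin
      + colCount m (suc s) L [] - + colCount m s L []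
        ≡⟨ cong₂ (λ a b → + a - + b) (colCount-L (suc s)) (colCount-L s) ⟩
      + colCount m (suc s) ρ [] + + q - (+ colCount m s ρ [] + + q)
        ≡⟨ cancel (+ colCount m (suc s) ρ []) (+ colCount m s ρ []) (+ q) ⟩
      + colCount m (suc s) ρ [] - + colCount m s ρ [] ∎)
      where
      open ≡-Reasoning
      cancel : ∀ a b c → a + c - (b + c) ≡ a - b
      cancel = solve-∀

    #H-∷-charge : ∀ r → Linked _≥_ (L ∷ r) →
      + #H (suc m) (L ∷ r) ≡ + colCount m (suc ρ) ρ [] + + q + charge m r (suc ρ) + + #H (suc m) r
    #H-∷-charge r lk = begin
      + (#H (suc m) (L ∷ r))
        ≡⟨ cong +_ (#H-∷-colCount m L r r≤L) ⟩
      + colCount m (suc L) L r + + #H (suc m) r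
        ≡⟨ cong (_+ + #H (suc m) r) (colCount-charge m (suc L) L r (tail lk) r≤L) ⟩
      + colCount m (suc L) L [] + charge m r (suc L) + + #H (suc m) r
        ≡⟨ cong₂ (λ c k → + c + k + + #H (suc m) r) colCount-top charge-top ⟩
      + colCount m (suc ρ) ρ [] + + q + charge m r (suc ρ) + + #H (suc m) r ∎
      where
      open ≡-Reasoning
      r≤L : All (_≤ L) r
      r≤L = Linked-≥⇒All-≤ lk
      colCount-top : colCount m (suc L) L [] ≡ colCount m (suc ρ) ρ [] ℕ.+ q
      colCount-top = begin
        colCount m (suc L) L []                    ≡⟨ cong (λ l → colCount m (suc l) L []) L≡ρ+qt ⟩
        colCount m (suc ρ ℕ.+ q ℕ.* suc m) L []    ≡⟨ colCount-+-multiple m (suc ρ) q L [] ⟩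
        colCount m (suc ρ) L []                    ≡⟨ colCount-L (suc ρ) ⟩
        colCount m (suc ρ) ρ [] ℕ.+ q ∎
      charge-top : charge m r (suc L) ≡ charge m r (suc ρ)
      charge-top = trans (cong (λ l → charge m r (suc l)) L≡ρ+qt) (charge-+-multiple m r (suc ρ) q)

  -- The size of the 2-core with charge k.
  coreSize₂ : ℤ → ℤ
  coreSize₂ k = + 2 * (k * k) - k

  -- In by-residue, charge-∷ and #H-∷-charge involve colCount m s ρ [], which evaluates to a
  -- literal once ρ is fixed; these literals are the constants in each identity.
  module Step₂ {L : ℕ} {r : List ℕ} (lk : Linked _≥_ (L ∷ r))
               (IH : + sum r ≡ coreSize₂ (charge 1 r 0) + + 2 * + #H 2 r) where
    open ≡-Reasoning
    k H : ℤ
    k = charge 1 r 0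
    H = + #H 2 r
    charge₁ : charge 1 r 1 ≡ - k
    charge₁ = inverseʳ-unique k (charge 1 r 1) (charge-sum₂ r)
    q : ℕ
    q = L / 2
    new-size : ∀ {k′ h} → charge 1 (L ∷ r) 0 ≡ k′ → + #H 2 (L ∷ r) ≡ h →
               coreSize₂ k′ + + 2 * h ≡ coreSize₂ (charge 1 (L ∷ r) 0) + + 2 * + #H 2 (L ∷ r)
    new-size refl refl = refl
    by-residue : ∀ ρ → ρ < 2 → L ≡ ρ ℕ.+ q ℕ.* 2 →
      + sum (L ∷ r) ≡ coreSize₂ (charge 1 (L ∷ r) 0) + + 2 * + #H 2 (L ∷ r)
    by-residue 0 _ L≡ = begin
      + sum (L ∷ r)
        ≡⟨ trans (size-∷ r) (cong (λ n → + 0 + + q * + 2 + n) IH) ⟩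
      + 0 + + q * + 2 + (coreSize₂ k + + 2 * H)
        ≡⟨ identity (+ q) k H ⟩
      coreSize₂ (- k + 0ℤ) + + 2 * (+ q + - k + H)
        ≡⟨ new-size (trans (charge-∷ r 0) (cong (_+ 0ℤ) charge₁))
                    (trans (#H-∷-charge r lk) (cong (λ c → + q + c + H) charge₁)) ⟩
      coreSize₂ (charge 1 (L ∷ r) 0) + + 2 * + #H 2 (L ∷ r) ∎
      where
      open TopRow 1 window₂ _ q L≡
      identity : ∀ q k H → + 0 + q * + 2 + ((+ 2 * (k * k) - k) + + 2 * H)
                           ≡ (+ 2 * ((- k + 0ℤ) * (- k + 0ℤ)) - (- k + 0ℤ)) + + 2 * (q + - k + H)
      identity = solve-∀
    by-residue 1 _ L≡ = begin
      + sum (L ∷ r)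
        ≡⟨ trans (size-∷ r) (cong (λ n → + 1 + + q * + 2 + n) IH) ⟩
      + 1 + + q * + 2 + (coreSize₂ k + + 2 * H)
        ≡⟨ identity (+ q) k H ⟩
      coreSize₂ (- k + + 1) + + 2 * (+ q + k + H)
        ≡⟨ new-size (trans (charge-∷ r 0) (cong (_+ + 1) charge₁))
                    (trans (#H-∷-charge r lk) (cong (λ c → + q + c + H) (charge-+-multiple 1 r 0 1))) ⟩
      coreSize₂ (charge 1 (L ∷ r) 0) + + 2 * + #H 2 (L ∷ r) ∎
      where
      open TopRow 1 window₂ _ q L≡
      identity : ∀ q k H → + 1 + q * + 2 + ((+ 2 * (k * k) - k) + + 2 * H)
                           ≡ (+ 2 * ((- k + + 1) * (- k + + 1)) - (- k + + 1)) + + 2 * (q + k + H)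
      identity = solve-∀
    by-residue (suc (suc _)) (s≤s (s≤s ())) _

  size≡coreSize₂+2#H₂ : ∀ λs → Linked _≥_ λs → + sum λs ≡ coreSize₂ (charge 1 λs 0) + + 2 * + #H 2 λs
  size≡coreSize₂+2#H₂ []      _  = refl
  size≡coreSize₂+2#H₂ (L ∷ r) lk = by-residue (L % 2) (m%n<n L 2) (m≡m%n+[m/n]*n L 2)
    where open Step₂ lk (size≡coreSize₂+2#H₂ r (tail lk))

  -- The size of the 3-core with charges x, y and −x − y.
  coreSize₃ : ℤ → ℤ → ℤ
  coreSize₃ x y = + 3 * (x * x + x * y + y * y) - x + y

  module Step₃ {L : ℕ} {r : List ℕ} (lk : Linked _≥_ (L ∷ r))
               (IH : + sum r ≡ coreSize₃ (charge 2 r 0) (charge 2 r 1) + + 3 * + #H 3 r) where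
    open ≡-Reasoning
    x y H : ℤ
    x = charge 2 r 0
    y = charge 2 r 1
    H = + #H 3 r
    charge₂ : charge 2 r 2 ≡ - (x + y)
    charge₂ = inverseʳ-unique (x + y) (charge 2 r 2) (charge-sum₃ r)
    q : ℕ
    q = L / 3
    new-size : ∀ {x′ y′ h} → charge 2 (L ∷ r) 0 ≡ x′ → charge 2 (L ∷ r) 1 ≡ y′ → + #H 3 (L ∷ r) ≡ h →
               coreSize₃ x′ y′ + + 3 * h ≡ coreSize₃ (charge 2 (L ∷ r) 0) (charge 2 (L ∷ r) 1) + + 3 * + #H 3 (L ∷ r)
    new-size refl refl refl = refl
    by-residue : ∀ ρ → ρ < 3 → L ≡ ρ ℕ.+ q ℕ.* 3 →
      + sum (L ∷ r) ≡ coreSize₃ (charge 2 (L ∷ r) 0) (charge 2 (L ∷ r) 1) + + 3 * + #H 3 (L ∷ r)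
    by-residue 0 _ L≡ = begin
      + sum (L ∷ r)
        ≡⟨ trans (size-∷ r) (cong (λ n → + 0 + + q * + 3 + n) IH) ⟩
      + 0 + + q * + 3 + (coreSize₃ x y + + 3 * H)
        ≡⟨ identity (+ q) x y H ⟩
      coreSize₃ (y + 0ℤ) (- (x + y) + 0ℤ) + + 3 * (+ q + y + H)
        ≡⟨ new-size (charge-∷ r 0) (trans (charge-∷ r 1) (cong (_+ 0ℤ) charge₂)) (#H-∷-charge r lk) ⟩
      coreSize₃ (charge 2 (L ∷ r) 0) (charge 2 (L ∷ r) 1) + + 3 * + #H 3 (L ∷ r) ∎
      where
      open TopRow 2 window₃ _ q L≡
      identity : ∀ q x y H →
        + 0 + q * + 3 + ((+ 3 * (x * x + x * y + y * y) - x + y) + + 3 * H)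
        ≡ (+ 3 * ((y + 0ℤ) * (y + 0ℤ) + (y + 0ℤ) * (- (x + y) + 0ℤ) + (- (x + y) + 0ℤ) * (- (x + y) + 0ℤ))
             - (y + 0ℤ) + (- (x + y) + 0ℤ)) + + 3 * (q + y + H)
      identity = solve-∀
    by-residue 1 _ L≡ = begin
      + sum (L ∷ r)
        ≡⟨ trans (size-∷ r) (cong (λ n → + 1 + + q * + 3 + n) IH) ⟩
      + 1 + + q * + 3 + (coreSize₃ x y + + 3 * H)
        ≡⟨ identity (+ q) x y H ⟩
      coreSize₃ (y + + 1) (- (x + y) - + 1) + + 3 * (+ q + - (x + y) + H)
        ≡⟨ new-size (charge-∷ r 0) (trans (charge-∷ r 1) (cong (_- + 1) charge₂))
                    (trans (#H-∷-charge r lk) (cong (λ c → + q + c + H) charge₂)) ⟩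
      coreSize₃ (charge 2 (L ∷ r) 0) (charge 2 (L ∷ r) 1) + + 3 * + #H 3 (L ∷ r) ∎
      where
      open TopRow 2 window₃ _ q L≡
      identity : ∀ q x y H →
        + 1 + q * + 3 + ((+ 3 * (x * x + x * y + y * y) - x + y) + + 3 * H)
        ≡ (+ 3 * ((y + + 1) * (y + + 1) + (y + + 1) * (- (x + y) - + 1) + (- (x + y) - + 1) * (- (x + y) - + 1))
             - (y + + 1) + (- (x + y) - + 1)) + + 3 * (q + - (x + y) + H)
      identity = solve-∀
    by-residue 2 _ L≡ = begin
      + sum (L ∷ r)
        ≡⟨ trans (size-∷ r) (cong (λ n → + 2 + + q * + 3 + n) IH) ⟩
      + 2 + + q * + 3 + (coreSize₃ x y + + 3 * H)
        ≡⟨ identity (+ q) x y H ⟩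
      coreSize₃ (y + + 1) (- (x + y) + 0ℤ) + + 3 * (+ q + x + H)
        ≡⟨ new-size (charge-∷ r 0) (trans (charge-∷ r 1) (cong (_+ 0ℤ) charge₂))
                    (trans (#H-∷-charge r lk) (cong (λ c → + q + c + H) (charge-+-multiple 2 r 0 1))) ⟩
      coreSize₃ (charge 2 (L ∷ r) 0) (charge 2 (L ∷ r) 1) + + 3 * + #H 3 (L ∷ r) ∎
      where
      open TopRow 2 window₃ _ q L≡
      identity : ∀ q x y H →
        + 2 + q * + 3 + ((+ 3 * (x * x + x * y + y * y) - x + y) + + 3 * H)
        ≡ (+ 3 * ((y + + 1) * (y + + 1) + (y + + 1) * (- (x + y) + 0ℤ) + (- (x + y) + 0ℤ) * (- (x + y) + 0ℤ))
             - (y + + 1) + (- (x + y) + 0ℤ)) + + 3 * (q + x + H)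
      identity = solve-∀
    by-residue (suc (suc (suc _))) (s≤s (s≤s (s≤s ()))) _

  size≡coreSize₃+3#H₃ : ∀ λs → Linked _≥_ λs →
    + sum λs ≡ coreSize₃ (charge 2 λs 0) (charge 2 λs 1) + + 3 * + #H 3 λs
  size≡coreSize₃+3#H₃ []      _  = refl
  size≡coreSize₃+3#H₃ (L ∷ r) lk = by-residue (L % 3) (m%n<n L 3) (m≡m%n+[m/n]*n L 3)
    where open Step₃ lk (size≡coreSize₃+3#H₃ r (tail lk))

  [4k-1]²≡8size-16#H₂+1 : ∀ λs → Linked _≥_ λs → let k = charge 1 λs 0 in
    (+ 4 * k - + 1) * (+ 4 * k - + 1) ≡ + 8 * + sum λs + - + 16 * + #H 2 λs + + 1
  [4k-1]²≡8size-16#H₂+1 λs lk = begin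
    (+ 4 * k - + 1) * (+ 4 * k - + 1)                  ≡⟨ expand k H ⟩
    + 8 * (coreSize₂ k + + 2 * H) + - + 16 * H + + 1   ≡⟨ cong (λ s → + 8 * s + - + 16 * H + + 1)
                                                              (sym (size≡coreSize₂+2#H₂ λs lk)) ⟩
    + 8 * + sum λs + - + 16 * H + + 1                  ∎
    where
    open ≡-Reasoning
    k H : ℤ
    k = charge 1 λs 0
    H = + #H 2 λs
    expand : ∀ k H → (+ 4 * k - + 1) * (+ 4 * k - + 1) ≡ + 8 * ((+ 2 * (k * k) - k) + + 2 * H) + - + 16 * H + + 1
    expand = solve-∀

  u²+uv+v²≡3size-9#H₃+1 : ∀ λs → Linked _≥_ λs →
    let x = charge 2 λs 0 ; y = charge 2 λs 1 ; u = - + 3 * x - + 3 * y ; v = + 3 * y + + 1 in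
    u * u + u * v + v * v ≡ + 3 * + sum λs + - + 9 * + #H 3 λs + + 1
  u²+uv+v²≡3size-9#H₃+1 λs lk = begin
    u * u + u * v + v * v                               ≡⟨ expand x y H ⟩
    + 3 * (coreSize₃ x y + + 3 * H) + - + 9 * H + + 1   ≡⟨ cong (λ s → + 3 * s + - + 9 * H + + 1)
                                                               (sym (size≡coreSize₃+3#H₃ λs lk)) ⟩
    + 3 * + sum λs + - + 9 * H + + 1                    ∎
    where
    open ≡-Reasoning
    x y u v H : ℤ
    x = charge 2 λs 0
    y = charge 2 λs 1
    u = - + 3 * x - + 3 * y
    v = + 3 * y + + 1
    H = + #H 3 λs
    expand : ∀ x y H → let u = - + 3 * x - + 3 * y ; v = + 3 * y + + 1 in
             u * u + u * v + v * v ≡ + 3 * ((+ 3 * (x * x + x * y + y * y) - x + y) + + 3 * H) + - + 9 * H + + 1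
    expand = solve-∀

module Modulo (n : ℕ) where

  import Data.Nat as ℕ
  open import Data.Nat using (zero; suc)
  open import Data.Integer using (ℤ; +_; _+_; _-_; _*_; -_; _^_)
  open import Data.Integer.Divisibility.Signed using (_∣_; divides; ∣ᵤ⇒∣; ∣-trans; ∣m⇒∣-m; ∣m∣n⇒∣m+n; ∣m⇒∣m*n; ∣n⇒∣m*n)
  open import Data.Integer.Tactic.RingSolver using (solve-∀)
  open import Relation.Binary.Bundles using (Setoid)
  open import Relation.Binary.Structures using (IsEquivalence)
  open import Relation.Binary.PropositionalEquality using (_≡_; refl; subst; trans; cong)
  open import Data.Integer.Properties using (pos-+; pos-*)
  import Data.Nat.Properties as ℕP

  infix 4 _≈_
  record _≈_ (a b : ℤ) : Set where
    constructor mod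
    field n∣a-b : + n ∣ a - b
  open _≈_ public

  private
    ∣-by : ∀ {a b} → a ≡ b → + n ∣ a → + n ∣ b
    ∣-by = subst (+ n ∣_)

  ≈-refl : ∀ {a} → a ≈ a
  ≈-refl {a} = mod (divides (+ 0) (self-sub a (+ n)))
    where
    self-sub : ∀ a n → a - a ≡ + 0 * n
    self-sub = solve-∀

  ≈-sym : ∀ {a b} → a ≈ b → b ≈ a
  ≈-sym {a} {b} (mod n∣a-b) = mod (∣-by (neg-sub a b) (∣m⇒∣-m n∣a-b))
    where
    neg-sub : ∀ a b → - (a - b) ≡ b - a
    neg-sub = solve-∀

  ≈-trans : ∀ {a b c} → a ≈ b → b ≈ c → a ≈ c
  ≈-trans {a} {b} {c} (mod n∣a-b) (mod n∣b-c) = mod (∣-by (sub-sub a b c) (∣m∣n⇒∣m+n n∣a-b n∣b-c))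
    where
    sub-sub : ∀ a b c → (a - b) + (b - c) ≡ a - c
    sub-sub = solve-∀

  ≈-isEquivalence : IsEquivalence _≈_
  ≈-isEquivalence = record { refl = ≈-refl ; sym = ≈-sym ; trans = ≈-trans }

  ≈-setoid : Setoid _ _
  ≈-setoid = record { isEquivalence = ≈-isEquivalence }

  ≡⇒≈ : ∀ {a b} → a ≡ b → a ≈ b
  ≡⇒≈ refl = ≈-refl

  +-cong : ∀ {a b c d} → a ≈ b → c ≈ d → a + c ≈ b + d
  +-cong {a} {b} {c} {d} (mod n∣a-b) (mod n∣c-d) = mod (∣-by (sub-+ a b c d) (∣m∣n⇒∣m+n n∣a-b n∣c-d))
    where
    sub-+ : ∀ a b c d → (a - b) + (c - d) ≡ (a + c) - (b + d)
    sub-+ = solve-∀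

  *-cong : ∀ {a b c d} → a ≈ b → c ≈ d → a * c ≈ b * d
  *-cong {a} {b} {c} {d} (mod n∣a-b) (mod n∣c-d) =
    mod (∣-by (sub-* a b c d) (∣m∣n⇒∣m+n (∣m⇒∣m*n c n∣a-b) (∣n⇒∣m*n b n∣c-d)))
    where
    sub-* : ∀ a b c d → (a - b) * c + b * (c - d) ≡ a * c - b * d
    sub-* = solve-∀

  ^-cong : ∀ {a b} k → a ≈ b → a ^ k ≈ b ^ k
  ^-cong zero    a≈b = ≈-refl
  ^-cong (suc k) a≈b = *-cong a≈b (^-cong k a≈b)

  +-multiple : ∀ a k → a + k * + n ≈ a
  +-multiple a k = mod (divides k (add-sub a k (+ n)))
    where
    add-sub : ∀ a k n → (a + k * n) - a ≡ k * n
    add-sub = solve-∀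

  ∣-resp-≈ : ∀ {d a b} → + d ∣ + n → a ≈ b → + d ∣ b → + d ∣ a
  ∣-resp-≈ {d} {a} {b} d∣n (mod n∣a-b) d∣b = subst (+ d ∣_) (sub-add a b) (∣m∣n⇒∣m+n (∣-trans d∣n n∣a-b) d∣b)
    where
    sub-add : ∀ a b → (a - b) + b ≡ a
    sub-add = solve-∀

  ℕ-multiple+ : ∀ {x} k a → x ≡ n ℕ.* k ℕ.+ a → + x ≈ + a
  ℕ-multiple+ k a refl = ≈-trans (≡⇒≈ reorder) (+-multiple (+ a) (+ k))
    where
    reorder : + (n ℕ.* k ℕ.+ a) ≡ + a + + k * + n
    reorder = trans (cong +_ (trans (ℕP.+-comm _ a) (cong (a ℕ.+_) (ℕP.*-comm n k))))
                    (trans (pos-+ a (k ℕ.* n)) (cong (λ x → + a + x) (pos-* k n)))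

  [mod]⇒≈ : ∀ x a → x ≡ a [mod n ] → + x ≈ + a
  [mod]⇒≈ x a n∣x-a = mod (∣ᵤ⇒∣ n∣x-a)

module PrimeBinomial where
  open import Data.Nat
    using (ℕ; zero; suc; _+_; _*_; _^_; _∸_; _<_; _≤_; _!; NonZero; nonTrivial⇒≢1; ≢-nonZero⁻¹; z<s; s<s)
  open import Data.Nat.Properties
  open import Data.Nat.Divisibility using (_∣_; divides; quotient; ∣-trans; ∣1⇒≡1; ∣⇒≤; m∣m*n; ∣m∣n⇒∣m+n)
  open import Data.Nat.Primality using (Prime; euclidsLemma; prime⇒nonZero; prime⇒nonTrivial)
  open import Data.Nat.DivMod using (m/n*n≡m)
  open import Data.Nat.Combinatorics using (_C_; nCk≡n!/k![n-k]!; k![n∸k]!∣n!; nCn≡1)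
  open import Data.Nat.Tactic.RingSolver using (solve-∀)
  open import Data.Fin using (Fin; zero; suc; toℕ; fromℕ; inject₁)
  open import Data.Fin.Properties using (toℕ-fromℕ; toℕ-inject₁; toℕ<n)
  open import Data.Vec.Functional using (Vector; init)
  open import Data.Sum using (inj₁; inj₂)
  open import Data.Product using (Σ-syntax; _,_)
  open import Data.Empty using (⊥-elim)
  open import Relation.Nullary using (¬_)
  open import Relation.Binary.PropositionalEquality
  import Algebra.Properties.CommutativeSemiring.Binomial +-*-commutativeSemiring as Binomial
  open import Algebra.Bundles using (CommutativeSemiring)
  import Algebra.Properties.Semiring.Exp (CommutativeSemiring.semiring +-*-commutativeSemiring) as Exp
  import Algebra.Properties.Semiring.Mult (CommutativeSemiring.semiring +-*-commutativeSemiring) as Mult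
  open import Algebra.Properties.Monoid.Sum +-0-monoid using (sum; sum-init-last)

  prime∤! : ∀ {p} → Prime p → ∀ {j} → j < p → ¬ p ∣ j !
  prime∤! p-prime {zero}  _   p∣1 = nonTrivial⇒≢1 {{prime⇒nonTrivial p-prime}} (∣1⇒≡1 p∣1)
  prime∤! p-prime {suc j} j<p p∣j! with euclidsLemma (suc j) (j !) p-prime p∣j!
  ... | inj₁ p∣1+j = <⇒≱ j<p (∣⇒≤ p∣1+j)
  ... | inj₂ p∣j!  = prime∤! p-prime (<-trans (n<1+n j) j<p) p∣j!

  prime∣C : ∀ {p k} → Prime p → 0 < k → k < p → p ∣ p C k
  prime∣C {p} {k} p-prime 0<k k<p with euclidsLemma (p C k) (k ! * (p ∸ k) !) p-prime p∣C*k!*[p-k]!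
    where
    instance _ = k !* (p ∸ k) !≢0
    p∣C*k!*[p-k]! : p ∣ (p C k) * (k ! * (p ∸ k) !)
    p∣C*k!*[p-k]! = subst (p ∣_) (sym (trans (cong (_* (k ! * (p ∸ k) !)) (nCk≡n!/k![n-k]! (<⇒≤ k<p)))
                                            (m/n*n≡m (k![n∸k]!∣n! (<⇒≤ k<p)))))
                                (p∣p! (prime⇒nonZero p-prime))
      where
      p∣p! : ∀ {p} → NonZero p → p ∣ p !
      p∣p! {suc p} _ = m∣m*n (p !)
  ... | inj₁ p∣C = p∣C
  ... | inj₂ p∣k!*[p-k]! with euclidsLemma (k !) ((p ∸ k) !) p-prime p∣k!*[p-k]!
  ...   | inj₁ p∣k!     = ⊥-elim (prime∤! p-prime k<p p∣k!)
  ...   | inj₂ p∣[p-k]! = ⊥-elim (prime∤! p-prime (∸-monoʳ-< 0<k (<⇒≤ k<p)) p∣[p-k]!)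

  ∣-sum : ∀ {d n} (t : Vector ℕ n) → (∀ i → d ∣ t i) → d ∣ sum t
  ∣-sum {n = zero}  t d∣t = divides 0 refl
  ∣-sum {n = suc n} t d∣t = ∣m∣n⇒∣m+n (d∣t zero) (∣-sum (λ i → t (suc i)) (λ i → d∣t (suc i)))

  ^≡Exp^ : ∀ x k → x ^ k ≡ x Exp.^ k
  ^≡Exp^ x zero    = refl
  ^≡Exp^ x (suc k) = cong (x *_) (^≡Exp^ x k)

  *≡Mult× : ∀ c x → c * x ≡ c Mult.× x
  *≡Mult× zero    x = refl
  *≡Mult× (suc c) x = cong (x +_) (*≡Mult× c x)

  binomialTerm-first : ∀ x n → Binomial.binomialTerm x 1 n zero ≡ 1
  binomialTerm-first x n = trans (+-identityʳ _) (trans (*-identityˡ _) (trans (sym (^≡Exp^ 1 n)) (^-zeroˡ n)))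

  binomialTerm-last : ∀ x n → Binomial.binomialTerm x 1 n (fromℕ n) ≡ x ^ n
  binomialTerm-last x n = begin
    (n C toℕ (fromℕ n)) Mult.× (x Exp.^ toℕ (fromℕ n) * 1 Exp.^ (n ∸ toℕ (fromℕ n)))
      ≡⟨ cong (λ j → (n C j) Mult.× (x Exp.^ j * 1 Exp.^ (n ∸ j))) (toℕ-fromℕ n) ⟩
    (n C n) Mult.× (x Exp.^ n * 1 Exp.^ (n ∸ n))  ≡⟨ sym (*≡Mult× (n C n) _) ⟩
    (n C n) * (x Exp.^ n * 1 Exp.^ (n ∸ n))       ≡⟨ cong₂ (λ c d → c * (x Exp.^ n * 1 Exp.^ d)) (nCn≡1 n) (n∸n≡0 n) ⟩
    1 * (x Exp.^ n * 1)                            ≡⟨ trans (*-identityˡ _) (*-identityʳ _) ⟩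
    x Exp.^ n                                      ≡⟨ sym (^≡Exp^ x n) ⟩
    x ^ n ∎
    where open ≡-Reasoning

  prime∣binomialTerm : ∀ {p′} → Prime (suc p′) → ∀ x (i : Fin p′) →
    suc p′ ∣ Binomial.binomialTerm x 1 (suc p′) (suc (inject₁ i))
  prime∣binomialTerm {p′} p-prime x i =
    subst (suc p′ ∣_) (*≡Mult× (suc p′ C k) _) (∣-trans (prime∣C p-prime z<s k<p) (m∣m*n _))
    where
    k : ℕ
    k = suc (toℕ (inject₁ i))
    k<p : k < suc p′
    k<p = s<s (subst (_< p′) (sym (toℕ-inject₁ i)) (toℕ<n i))

  freshman : ∀ {p} → Prime p → ∀ n → Σ[ c ∈ ℕ ] (n + 1) ^ p ≡ n ^ p + 1 + c * p
  freshman {zero}       p-prime n = ⊥-elim (≢-nonZero⁻¹ 0 {{prime⇒nonZero p-prime}} refl)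
  freshman {p@(suc p′)} p-prime n = quotient middle∣ , (begin
    (n + 1) ^ p                                    ≡⟨ ^≡Exp^ (n + 1) p ⟩
    (n + 1) Exp.^ p                                ≡⟨ Binomial.theorem p n 1 ⟩
    term zero + sum (λ k → term (suc k))           ≡⟨ cong (term zero +_) (sum-init-last (λ k → term (suc k))) ⟩
    term zero + (sum middle + term (fromℕ p))      ≡⟨ cong₂ (λ a b → a + (b + term (fromℕ p)))
                                                            (binomialTerm-first n p) (_∣_.equality middle∣) ⟩
    1 + (quotient middle∣ * p + term (fromℕ p))    ≡⟨ cong (λ a → 1 + (quotient middle∣ * p + a)) (binomialTerm-last n p) ⟩
    1 + (quotient middle∣ * p + n ^ p)             ≡⟨ regroup (quotient middle∣ * p) (n ^ p) ⟩
    n ^ p + 1 + quotient middle∣ * p ∎)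
    where
    open ≡-Reasoning
    term : Fin (suc p) → ℕ
    term = Binomial.binomialTerm n 1 p
    middle : Vector ℕ p′
    middle = init (λ k → term (suc k))
    middle∣ : p ∣ sum middle
    middle∣ = ∣-sum middle (prime∣binomialTerm p-prime n)
    regroup : ∀ a b → 1 + (a + b) ≡ b + 1 + a
    regroup = solve-∀

module Fermat where
  open PrimeBinomial
  import Data.Nat as ℕ
  open import Data.Nat using (ℕ; zero; suc)
  open import Data.Nat.Properties using (suc-pred; +-comm)
  open import Data.Nat.Primality using (Prime; prime⇒nonZero)
  open import Data.Integer using (0ℤ; +_; -[1+_]; _+_; _-_; _*_; -_; _^_)
  open import Data.Integer.Properties using (pos-+; pos-*)
  open import Data.Integer.Tactic.RingSolver using (solve-∀)
  open import Data.Product using (proj₁; proj₂)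
  open import Relation.Binary.PropositionalEquality
  import Relation.Binary.Reasoning.Setoid as SetoidReasoning

  pos-^ : ∀ m k → + (m ℕ.^ k) ≡ (+ m) ^ k
  pos-^ m zero    = refl
  pos-^ m (suc k) = trans (pos-* m (m ℕ.^ k)) (cong (+ m *_) (pos-^ m k))

  0ℤ^n≡0ℤ : ∀ n → .{{ℕ.NonZero n}} → 0ℤ ^ n ≡ 0ℤ
  0ℤ^n≡0ℤ (suc n) = refl

  -[1+n]+[1+n]*[1+q] : ∀ n q → -[1+ n ] + + suc n * + suc q ≡ + (suc n ℕ.* q)
  -[1+n]+[1+n]*[1+q] n q = trans (regroup (+ suc n) (+ q)) (sym (pos-* (suc n) q))
    where
    regroup : ∀ N q → - N + N * (+ 1 + q) ≡ N * q
    regroup = solve-∀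

  module _ {p} (p-prime : Prime p) where
    open Modulo p
    instance _ = prime⇒nonZero p-prime
    open SetoidReasoning ≈-setoid

    fermat-ℕ : ∀ n → (+ n) ^ p ≈ + n
    fermat-ℕ zero    = ≡⇒≈ (0ℤ^n≡0ℤ p)
    fermat-ℕ (suc n) = begin
      (+ suc n) ^ p                        ≡⟨ cong (λ m → (+ m) ^ p) (+-comm 1 n) ⟩
      (+ (n ℕ.+ 1)) ^ p                    ≡⟨ sym (pos-^ (n ℕ.+ 1) p) ⟩
      + ((n ℕ.+ 1) ℕ.^ p)                  ≡⟨ cong +_ (proj₂ (freshman p-prime n)) ⟩
      + (n ℕ.^ p ℕ.+ 1 ℕ.+ c ℕ.* p)        ≡⟨ trans (pos-+ (n ℕ.^ p ℕ.+ 1) (c ℕ.* p))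
                                                 (cong₂ _+_ (trans (pos-+ (n ℕ.^ p) 1) (cong (_+ + 1) (pos-^ n p))) (pos-* c p)) ⟩
      (+ n) ^ p + + 1 + + c * + p           ≈⟨ +-multiple _ (+ c) ⟩
      (+ n) ^ p + + 1                       ≈⟨ +-cong (fermat-ℕ n) ≈-refl ⟩
      + n + + 1                             ≡⟨ cong +_ (+-comm n 1) ⟩
      + suc n ∎
      where
      c : ℕ
      c = proj₁ (freshman p-prime n)

    fermat : ∀ a → a ^ p ≈ a
    fermat (+ n)    = fermat-ℕ n
    fermat -[1+ n ] = begin
      -[1+ n ] ^ p      ≈⟨ ^-cong p -[1+n]≈r ⟩
      (+ r) ^ p         ≈⟨ fermat-ℕ r ⟩
      + r               ≈⟨ ≈-sym -[1+n]≈r ⟩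
      -[1+ n ] ∎
      where
      r : ℕ
      r = suc n ℕ.* ℕ.pred p
      -[1+n]≈r : -[1+ n ] ≈ + r
      -[1+n]≈r = ≈-trans (≈-sym (+-multiple -[1+ n ] (+ suc n)))
                         (≡⇒≈ (trans (cong (λ q → -[1+ n ] + + suc n * + q) (sym (suc-pred p)))
                                     (-[1+n]+[1+n]*[1+q] n (ℕ.pred p))))

module EisensteinNorm where
  open Fermat
  import Data.Nat as ℕ
  open import Data.Nat using (ℕ; suc; _%_; _/_; s≤s)
  open import Data.Nat.Properties using (*-comm)
  open import Data.Nat.DivMod using (m≡m%n+[m/n]*n)
  import Data.Nat.Divisibility as ℕ∣
  open import Data.Nat.Primality using (Prime; euclidsLemma)
  import Data.Integer as ℤ
  open import Data.Integer using (ℤ; +_; _+_; _-_; _*_; -_; _^_)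
  open import Data.Integer.Properties using (abs-*; *-identityʳ; ^-distribˡ-+-*; ^-*-assoc)
  open import Data.Integer.Divisibility.Signed using (_∣_; divides; ∣ᵤ⇒∣; ∣⇒∣ᵤ; ∣m⇒∣-m; ∣m∣n⇒∣m-n; ∣m⇒∣m*n; ∣n⇒∣m*n)
  open import Data.Integer.Tactic.RingSolver using (solve-∀)
  open import Data.Sum using (_⊎_; inj₁; inj₂; reduce)
  open import Data.Product using (_×_; _,_)
  open import Data.Empty using (⊥-elim)
  open import Relation.Nullary using (¬_)
  open import Relation.Binary.PropositionalEquality
  import Relation.Binary.Reasoning.Setoid as SetoidReasoning

  module _ {p} (p-prime : Prime p) where

    prime∣*⇒∣⊎∣ : ∀ a b → + p ∣ a * b → + p ∣ a ⊎ + p ∣ b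
    prime∣*⇒∣⊎∣ a b p∣ab
      with euclidsLemma ℤ.∣ a ∣ ℤ.∣ b ∣ p-prime (subst (ℕ∣._∣_ p) (abs-* a b) (∣⇒∣ᵤ p∣ab))
    ... | inj₁ p∣a = inj₁ (∣ᵤ⇒∣ p∣a)
    ... | inj₂ p∣b = inj₂ (∣ᵤ⇒∣ p∣b)

    prime∣²⇒∣ : ∀ a → + p ∣ a * a → + p ∣ a
    prime∣²⇒∣ a p∣a² = reduce (prime∣*⇒∣⊎∣ a a p∣a²)

  module _ {p} (p-prime : Prime p) (p%3≡2 : p % 3 ≡ 2) where
    open Modulo p

    prime∤3 : ¬ + p ∣ + 3
    prime∤3 p∣3 = excluded p p%3≡2 (ℕ∣.∣⇒≤ (∣⇒∣ᵤ p∣3)) (∣⇒∣ᵤ p∣3)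
      where
      excluded : ∀ q → q % 3 ≡ 2 → q ℕ.≤ 3 → ¬ ℕ∣._∣_ q 3
      excluded 2 _ _ (ℕ∣.divides (suc (suc _)) ())
      excluded 2 _ _ (ℕ∣.divides 1 ())
      excluded 2 _ _ (ℕ∣.divides 0 ())
      excluded (suc (suc (suc (suc _)))) _ (s≤s (s≤s (s≤s ()))) _

    prime∣3*⇒∣ : ∀ a → + p ∣ + 3 * a → + p ∣ a
    prime∣3*⇒∣ a p∣3a with prime∣*⇒∣⊎∣ p-prime (+ 3) a p∣3a
    ... | inj₁ p∣3 = ⊥-elim (prime∤3 p∣3)
    ... | inj₂ p∣a = p∣a

    ^p≡²*³^ : ∀ w → w ^ p ≡ (w * w) * (w ^ 3) ^ (p / 3)
    ^p≡²*³^ w = begin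
      w ^ p                        ≡⟨ cong (w ^_) (trans (m≡m%n+[m/n]*n p 3) (cong (ℕ._+ p / 3 ℕ.* 3) p%3≡2)) ⟩
      w ^ (2 ℕ.+ p / 3 ℕ.* 3)      ≡⟨ ^-distribˡ-+-* w 2 (p / 3 ℕ.* 3) ⟩
      w ^ 2 * w ^ (p / 3 ℕ.* 3)    ≡⟨ cong₂ _*_ (cong (w *_) (*-identityʳ w))
                                              (trans (cong (w ^_) (*-comm (p / 3) 3)) (sym (^-*-assoc w 3 (p / 3)))) ⟩
      (w * w) * (w ^ 3) ^ (p / 3)  ∎
      where open ≡-Reasoning

    -- With p = 3k + 2: u ≡ u^p = u²(u³)^k ≡ u²(v³)^k, since u³ − v³ = (u − v)(u² + uv + v²),
    -- and v ≡ v²(v³)^k; hence u·v² ≡ v·u².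
    ∣u²+uv+v²⇒∣uv[v-u] : ∀ u v → + p ∣ u * u + u * v + v * v → + p ∣ (u * v) * (v - u)
    ∣u²+uv+v²⇒∣uv[v-u] u v p∣N = subst (+ p ∣_) (factor u v) (n∣a-b uv²≈vu²)
      where
      open SetoidReasoning ≈-setoid
      W : ℤ
      W = (v ^ 3) ^ (p / 3)
      u³≈v³ : u ^ 3 ≈ v ^ 3
      u³≈v³ = mod (subst (+ p ∣_) (cube-difference u v) (∣n⇒∣m*n (u - v) p∣N))
        where
        cube-difference : ∀ u v → (u - v) * (u * u + u * v + v * v) ≡ u * (u * (u * + 1)) - v * (v * (v * + 1))
        cube-difference = solve-∀
      u≈u²W : u ≈ (u * u) * W
      u≈u²W = begin
        u                            ≈⟨ ≈-sym (fermat p-prime u) ⟩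
        u ^ p                        ≡⟨ ^p≡²*³^ u ⟩
        (u * u) * (u ^ 3) ^ (p / 3)  ≈⟨ *-cong (≈-refl {u * u}) (^-cong (p / 3) u³≈v³) ⟩
        (u * u) * W                  ∎
      v≈v²W : v ≈ (v * v) * W
      v≈v²W = ≈-trans (≈-sym (fermat p-prime v)) (≡⇒≈ (^p≡²*³^ v))
      uv²≈vu² : u * (v * v) ≈ v * (u * u)
      uv²≈vu² = begin
        u * (v * v)                  ≈⟨ *-cong u≈u²W (≈-refl {v * v}) ⟩
        ((u * u) * W) * (v * v)      ≡⟨ swap (u * u) (v * v) W ⟩
        ((v * v) * W) * (u * u)      ≈⟨ *-cong (≈-sym v≈v²W) (≈-refl {u * u}) ⟩
        v * (u * u)                  ∎
        where
        swap : ∀ a b w → (a * w) * b ≡ (b * w) * a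
        swap = solve-∀
      factor : ∀ u v → u * (v * v) - v * (u * u) ≡ (u * v) * (v - u)
      factor = solve-∀

    ∣u²+uv+v²∧∣u⇒∣v : ∀ u v → + p ∣ u * u + u * v + v * v → + p ∣ u → + p ∣ v
    ∣u²+uv+v²∧∣u⇒∣v u v p∣N p∣u = prime∣²⇒∣ p-prime v (subst (+ p ∣_) (complete u v) p∣N-u[u+v])
      where
      complete : ∀ u v → (u * u + u * v + v * v) - u * (u + v) ≡ v * v
      complete = solve-∀
      p∣N-u[u+v] : + p ∣ (u * u + u * v + v * v) - u * (u + v)
      p∣N-u[u+v] = ∣m∣n⇒∣m-n p∣N (∣m⇒∣m*n (u + v) p∣u)

    ∣u²+uv+v²∧∣v⇒∣u : ∀ u v → + p ∣ u * u + u * v + v * v → + p ∣ v → + p ∣ u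
    ∣u²+uv+v²∧∣v⇒∣u u v p∣N p∣v = prime∣²⇒∣ p-prime u (subst (+ p ∣_) (complete u v) p∣N-v[u+v])
      where
      complete : ∀ u v → (u * u + u * v + v * v) - v * (u + v) ≡ u * u
      complete = solve-∀
      p∣N-v[u+v] : + p ∣ (u * u + u * v + v * v) - v * (u + v)
      p∣N-v[u+v] = ∣m∣n⇒∣m-n p∣N (∣m⇒∣m*n (u + v) p∣v)

    ∣u²+uv+v²∧∣v-u⇒∣v : ∀ u v → + p ∣ u * u + u * v + v * v → + p ∣ v - u → + p ∣ v
    ∣u²+uv+v²∧∣v-u⇒∣v u v p∣N p∣v-u =
      prime∣²⇒∣ p-prime v (prime∣3*⇒∣ (v * v) (subst (+ p ∣_) (complete u v) p∣N-[u-v][u+2v]))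
      where
      complete : ∀ u v → (u * u + u * v + v * v) - (- (v - u)) * (u + + 2 * v) ≡ + 3 * (v * v)
      complete = solve-∀
      p∣N-[u-v][u+2v] : + p ∣ (u * u + u * v + v * v) - (- (v - u)) * (u + + 2 * v)
      p∣N-[u-v][u+2v] = ∣m∣n⇒∣m-n p∣N (∣m⇒∣m*n (u + + 2 * v) (∣m⇒∣-m p∣v-u))

    ∣u²+uv+v²⇒∣u×∣v : ∀ u v → + p ∣ u * u + u * v + v * v → + p ∣ u × + p ∣ v
    ∣u²+uv+v²⇒∣u×∣v u v p∣N = by-cases (prime∣*⇒∣⊎∣ p-prime (u * v) (v - u) (∣u²+uv+v²⇒∣uv[v-u] u v p∣N))
      where
      by-cases : + p ∣ u * v ⊎ + p ∣ v - u → + p ∣ u × + p ∣ v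
      by-cases (inj₁ p∣uv) with prime∣*⇒∣⊎∣ p-prime u v p∣uv
      ... | inj₁ p∣u = p∣u , ∣u²+uv+v²∧∣u⇒∣v u v p∣N p∣u
      ... | inj₂ p∣v = ∣u²+uv+v²∧∣v⇒∣u u v p∣N p∣v , p∣v
      by-cases (inj₂ p∣v-u) = subst (+ p ∣_) (sub-sub u v) p∣v-[v-u] , p∣v
        where
        p∣v : + p ∣ v
        p∣v = ∣u²+uv+v²∧∣v-u⇒∣v u v p∣N p∣v-u
        p∣v-[v-u] : + p ∣ v - (v - u)
        p∣v-[v-u] = ∣m∣n⇒∣m-n p∣v p∣v-u
        sub-sub : ∀ u v → v - (v - u) ≡ u
        sub-sub = solve-∀

  ∣u∧∣v⇒²∣u²+uv+v² : ∀ {d u v} → d ∣ u → d ∣ v → d * d ∣ u * u + u * v + v * v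
  ∣u∧∣v⇒²∣u²+uv+v² {d} (divides a refl) (divides b refl) = divides (a * a + a * b + b * b) (factor a b d)
    where
    factor : ∀ a b d → (a * d) * (a * d) + (a * d) * (b * d) + (b * d) * (b * d) ≡ (a * a + a * b + b * b) * (d * d)
    factor = solve-∀

module Vanishing where
  open Charges
  open Fermat
  open EisensteinNorm
  open import Data.Nat.Primality using (Prime)
  import Data.Integer as ℤ
  import Data.Nat as ℕ
  import Data.Nat.Properties as ℕP
  open import Data.Nat using (ℕ; NonZero)
  open import Data.Nat.DivMod using (_%_; _/_; m%n<n; m≡m%n+[m/n]*n)
  import Data.Nat.Divisibility as ℕ∣
  open import Data.Nat.ListAction using (sum)
  open import Data.Integer using (ℤ; +_; -[1+_]; _+_; _-_; _*_; -_)
  open import Data.Integer.Divisibility.Signed using (_∣_; ∣ᵤ⇒∣; ∣⇒∣ᵤ; ∣-refl)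
  open import Data.Integer.Properties using (pos-*)
  open import Data.Product using (_×_; _,_; proj₁; proj₂)
  open import Data.Integer.Tactic.RingSolver using (solve-∀)
  open import Data.List using (upTo)
  open import Data.List.Relation.Unary.Any using (Any; any?)
  import Data.List.Relation.Unary.Any as Any
  open import Data.List.Membership.Propositional.Properties using (∈-upTo⁺)
  open import Relation.Nullary using (¬_; yes; no)
  open import Relation.Binary.PropositionalEquality using (_≡_; refl; cong; trans; sym; subst)
  import Relation.Binary.Reasoning.Setoid as SetoidReasoning

  legendre≡-1⇒¬root : ∀ m p → legendre m p ≡ -[1+ 0 ] → ¬ Any (λ x → ℕ∣._∣_ p ℤ.∣ + x * + x - m ∣) (upTo p)
  legendre≡-1⇒¬root m p legendre≡-1 with p ℕ∣.∣? ℤ.∣ m ∣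
  legendre≡-1⇒¬root m p () | yes _
  ... | no _ with any? (λ x → p ℕ∣.∣? ℤ.∣ + x * + x - m ∣) (upTo p)
  legendre≡-1⇒¬root m p () | no _ | yes _
  ... | no ¬root = ¬root

  ∣y∣*∣y∣≡y*y : ∀ y → + ℤ.∣ y ∣ * + ℤ.∣ y ∣ ≡ y * y
  ∣y∣*∣y∣≡y*y (+ n)     = refl
  ∣y∣*∣y∣≡y*y -[1+ n ]  = neg*neg (+ ℕ.suc n)
    where
    neg*neg : ∀ a → a * a ≡ (- a) * (- a)
    neg*neg = solve-∀

  -- legendre only tests the residues 0 ≤ x < p, so a square root y is replaced by ∣y∣ mod p.
  legendre≡-1⇒¬square : ∀ m p → .{{NonZero p}} → legendre m p ≡ -[1+ 0 ] → ∀ y → ¬ (+ p ∣ y * y - m)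
  legendre≡-1⇒¬square m p legendre≡-1 y p∣y²-m = legendre≡-1⇒¬root m p legendre≡-1
    (Any.map (λ { refl → ∣⇒∣ᵤ (n∣a-b x²≈m) }) (∈-upTo⁺ (m%n<n ℤ.∣ y ∣ p)))
    where
    open Modulo p
    open SetoidReasoning ≈-setoid
    x : ℕ
    x = ℤ.∣ y ∣ % p
    x²≈m : + x * + x ≈ m
    x²≈m = begin
      + x * + x                  ≈⟨ *-cong x≈∣y∣ x≈∣y∣ ⟩
      + ℤ.∣ y ∣ * + ℤ.∣ y ∣      ≡⟨ ∣y∣*∣y∣≡y*y y ⟩
      y * y                      ≈⟨ mod p∣y²-m ⟩
      m ∎
      where
      x≈∣y∣ : + x ≈ + ℤ.∣ y ∣
      x≈∣y∣ = ≈-sym (ℕ-multiple+ (ℤ.∣ y ∣ / p) x ∣y∣≡)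
        where
        ∣y∣≡ : ℤ.∣ y ∣ ≡ p ℕ.* (ℤ.∣ y ∣ / p) ℕ.+ x
        ∣y∣≡ = trans (m≡m%n+[m/n]*n ℤ.∣ y ∣ p) (trans (ℕP.+-comm x _) (cong (ℕ._+ x) (ℕP.*-comm _ p)))

  vanishing₂ : ∀ ℓ → .{{NonZero ℓ}} → ∀ a₁ a₂ → legendre (- (+ 16 * + a₁) + + 8 * + a₂ + + 1) ℓ ≡ -[1+ 0 ] →
               ∀ n → p-vanishes 2 a₁ ℓ (ℓ ℕ.* n ℕ.+ a₂)
  vanishing₂ ℓ a₁ a₂ legendre≡-1 n λp #H₂≡a₁ = legendre≡-1⇒¬square _ ℓ legendre≡-1 y (n∣a-b y²≈m)
    where
    open Modulo ℓ
    open SetoidReasoning ≈-setoid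
    y : ℤ
    y = + 4 * charge 1 (parts λp) 0 - + 1
    y²≈m : y * y ≈ - (+ 16 * + a₁) + + 8 * + a₂ + + 1
    y²≈m = begin
      y * y                                                    ≡⟨ [4k-1]²≡8size-16#H₂+1 (parts λp) (decr λp) ⟩
      + 8 * + sum (parts λp) + - + 16 * + #H 2 (parts λp) + + 1
        ≈⟨ +-cong (+-cong (*-cong (≈-refl {+ 8}) (ℕ-multiple+ n a₂ (total λp)))
                          (*-cong (≈-refl { - + 16}) ([mod]⇒≈ (#H 2 (parts λp)) a₁ #H₂≡a₁)))
                  (≈-refl {+ 1}) ⟩
      + 8 * + a₂ + - + 16 * + a₁ + + 1                         ≡⟨ reorder (+ a₁) (+ a₂) ⟩
      - (+ 16 * + a₁) + + 8 * + a₂ + + 1                       ∎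
      where
      reorder : ∀ a₁ a₂ → + 8 * a₂ + - + 16 * a₁ + + 1 ≡ - (+ 16 * a₁) + + 8 * a₂ + + 1
      reorder = solve-∀

  vanishing₃ : ∀ ℓ → Prime ℓ → ℓ % 3 ≡ 2 → ∀ a₁ a₂ → ord≡ ℓ (- (+ 9 * + a₁) + + 3 * + a₂ + + 1) 1 →
               ∀ n → p-vanishes 3 a₁ (ℓ ℕ.^ 2) (ℓ ℕ.^ 2 ℕ.* n ℕ.+ a₂)
  vanishing₃ ℓ ℓ-prime ℓ%3≡2 a₁ a₂ (ℓ∣m , ℓ²∤m) n λp #H₃≡a₁ = ℓ²∤m (∣⇒∣ᵤ ℓ²∣m)
    where
    open Modulo (ℓ ℕ.^ 2)
    open SetoidReasoning ≈-setoid
    m u v N : ℤ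
    m = - (+ 9 * + a₁) + + 3 * + a₂ + + 1
    u = - + 3 * charge 2 (parts λp) 0 - + 3 * charge 2 (parts λp) 1
    v = + 3 * charge 2 (parts λp) 1 + + 1
    N = u * u + u * v + v * v
    N≈m : N ≈ m
    N≈m = begin
      N                                                        ≡⟨ u²+uv+v²≡3size-9#H₃+1 (parts λp) (decr λp) ⟩
      + 3 * + sum (parts λp) + - + 9 * + #H 3 (parts λp) + + 1
        ≈⟨ +-cong (+-cong (*-cong (≈-refl {+ 3}) (ℕ-multiple+ n a₂ (total λp)))
                          (*-cong (≈-refl { - + 9}) ([mod]⇒≈ (#H 3 (parts λp)) a₁ #H₃≡a₁)))
                  (≈-refl {+ 1}) ⟩
      + 3 * + a₂ + - + 9 * + a₁ + + 1                          ≡⟨ reorder (+ a₁) (+ a₂) ⟩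
      m                                                        ∎
      where
      reorder : ∀ a₁ a₂ → + 3 * a₂ + - + 9 * a₁ + + 1 ≡ - (+ 9 * a₁) + + 3 * a₂ + + 1
      reorder = solve-∀
    ℓ∣N : + ℓ ∣ N
    ℓ∣N = ∣-resp-≈ (∣ᵤ⇒∣ (ℕ∣.m∣m*n (ℓ ℕ.* 1))) N≈m
                   (∣ᵤ⇒∣ (subst (λ d → ℕ∣._∣_ d ℤ.∣ m ∣) (ℕP.*-identityʳ ℓ) ℓ∣m))
    ℓ²∣N : + (ℓ ℕ.^ 2) ∣ N
    ℓ²∣N = subst (_∣ N) ℓ*ℓ≡ℓ² (∣u∧∣v⇒²∣u²+uv+v² (proj₁ ℓ∣u×ℓ∣v) (proj₂ ℓ∣u×ℓ∣v))
      where
      ℓ∣u×ℓ∣v : + ℓ ∣ u × + ℓ ∣ v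
      ℓ∣u×ℓ∣v = ∣u²+uv+v²⇒∣u×∣v ℓ-prime ℓ%3≡2 u v ℓ∣N
      ℓ*ℓ≡ℓ² : + ℓ * + ℓ ≡ + (ℓ ℕ.^ 2)
      ℓ*ℓ≡ℓ² = trans (sym (pos-* ℓ ℓ)) (cong (λ k → + (ℓ ℕ.* k)) (sym (ℕP.*-identityʳ ℓ)))
    ℓ²∣m : + (ℓ ℕ.^ 2) ∣ m
    ℓ²∣m = ∣-resp-≈ ∣-refl (≈-sym N≈m) ℓ²∣N

open import Data.Nat using (ℕ; _<_; _+_; _*_; _%_; _^_)
open import Data.Nat.Primality using (Prime; prime⇒nonZero)
open import Data.Integer as ℤ using (+_; -[1+_])
open import Data.Product using (_×_; _,_)
open import Relation.Binary.PropositionalEquality using (_≡_; _≢_)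

theorem1p5 : ((ℓ : ℕ) → Prime ℓ → ℓ ≢ 2 → (a₁ a₂ : ℕ) → a₁ < ℓ → a₂ < ℓ →
    legendre ((ℤ.- (+ 16 ℤ.* + a₁)) ℤ.+ (+ 8 ℤ.* + a₂) ℤ.+ + 1) ℓ ≡ -[1+ 0 ] →
    (n : ℕ) → p-vanishes 2 a₁ ℓ (ℓ * n + a₂))
    ×
    ((ℓ : ℕ) → Prime ℓ → ℓ % 3 ≡ 2 → (a₁ a₂ : ℕ) → a₁ < ℓ ^ 2 → a₂ < ℓ ^ 2 →
    ord≡ ℓ ((ℤ.- (+ 9 ℤ.* + a₁)) ℤ.+ (+ 3 ℤ.* + a₂) ℤ.+ + 1) 1 →
    (n : ℕ) → p-vanishes 3 a₁ (ℓ ^ 2) (ℓ ^ 2 * n + a₂))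
theorem1p5 =
  (λ ℓ ℓ-prime _ a₁ a₂ _ _ → Vanishing.vanishing₂ ℓ {{prime⇒nonZero ℓ-prime}} a₁ a₂) ,
  (λ ℓ ℓ-prime ℓ%3≡2 a₁ a₂ _ _ → Vanishing.vanishing₃ ℓ ℓ-prime ℓ%3≡2 a₁ a₂)
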